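{- Let $m>0$. Let $2\le a\le b\le c$ and $2\le a'\le b'\le c'\le c$ be integers such that $(F(a),F(b),F(c))$ and $(F(a'),F(b'),F(c'))$ are both minimal Markoff $m$-triples (for the same $m$). Suppose $a\in\{2,3\}$ and $c\ge 10$. Then $c'\ge c-1$, except in the case $a=3$ and $c=b+4$, where $c'\ge c-2$.
   Context: $F(n)$ denotes the $n$-th Fibonacci number, $F(0)=0$, $F(1)=1$, $F(n+1)=F(n)+F(n-1)$. A Markoff $m$-triple is a triple $(x,y,z)$ of positive integers with $x\le y\le z$ satisfying $x^2+y^2+z^2=3xyz+m$; it is minimal if $z\ge 3xy$. -}

module Defs where

open import Data.Nat using (ℕ; zero; suc; _+_; _*_; _≤_; _<_)
open import Data.Product using (_×_)

F : ℕ → ℕ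
F zero = 0
F (suc zero) = 1
F (suc (suc n)) = F (suc n) + F n

MarkoffTriple : ℕ → ℕ → ℕ → ℕ → Set
MarkoffTriple m x y z =
  (0 < x) × (x ≤ y) × (y ≤ z) × (x * x + y * y + z * z ≡ 3 * x * y * z + m)
  where open import Relation.Binary.PropositionalEquality using (_≡_)

MinimalMarkoffTriple : ℕ → ℕ → ℕ → ℕ → Set
MinimalMarkoffTriple m x y z = MarkoffTriple m x y z × (3 * x * y ≤ z)

-- A Markoff m-triple has x² + y² < 3xyz, hence m < z²; so m < F(c′)². Conversely, minimality
-- z ≥ 3xy with x = F a ∈ {1, 2} forces b ≤ c − 3 (resp. b ≤ c − 4), and x² + y² + z² − 3xyz
-- decreases in y on [0, z], so m is at least its value at the largest admissible b. The
-- Fibonacci addition formula evaluates that value, giving m ≥ F(c − 2)², or only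
-- m ≥ F(c − 3)² when a = 3 and b = c − 4. Comparing the bounds gives c − 2 < c′ (resp. c − 3 < c′).
module Submission where

open import Defs
open import Data.Nat using (ℕ; _+_; _≤_; _<_)
open import Data.Product using (_×_)
open import Data.Sum using (_⊎_)
open import Relation.Binary.PropositionalEquality using (_≡_)
open import Relation.Nullary using (¬_)

open import Data.Nat using (suc; _*_; z≤n; s≤s; _<?_; _≤?_; >-nonZero)
open import Data.Nat.Properties
open import Data.Nat.Tactic.RingSolver using (solve-∀)
open import Data.Product using (_,_)
open import Algebra.Definitions.RawMagma using (_,_)
open import Data.Sum using (inj₁; inj₂)
open import Relation.Nullary using (yes; no; contradiction)
open import Relation.Binary.PropositionalEquality using (refl; sym; cong; subst; subst₂; module ≡-Reasoning)
open import Function using (_∘_)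

F-≤-suc : ∀ n → F n ≤ F (suc n)
F-≤-suc 0 = z≤n
F-≤-suc (suc n) = m≤m+n (F (suc n)) (F n)

F-mono-≤ : ∀ {i j} → i ≤ j → F i ≤ F j
F-mono-≤ {j = 0} z≤n = ≤-refl
F-mono-≤ {j = suc j} i≤1+j with m≤n⇒m<n∨m≡n i≤1+j
... | inj₁ i<1+j = ≤-trans (F-mono-≤ (≤-pred i<1+j)) (F-≤-suc j)
... | inj₂ refl = ≤-refl

F-cancel-< : ∀ {i j} → F i < F j → i < j
F-cancel-< {i} {j} Fi<Fj with i <? j
... | yes i<j = i<j
... | no i≮j = contradiction (F-mono-≤ (≮⇒≥ i≮j)) (<⇒≱ Fi<Fj)

F-<-suc : ∀ {n} → 2 ≤ n → F n < F (suc n)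
F-<-suc {1} (s≤s ())
F-<-suc {suc (suc n)} _ = m<m+n (F (2 + n)) (F-mono-≤ {1} {suc n} (s≤s z≤n))

F-add : ∀ m n → F (suc (m + n)) ≡ F (suc m) * F (suc n) + F m * F n
F-add m 0 = begin
  F (suc (m + 0))          ≡⟨ cong (F ∘ suc) (+-identityʳ m) ⟩
  F (suc m)                ≡⟨ pad (F (suc m)) (F m) ⟩
  F (suc m) * 1 + F m * 0  ∎
  where
  open ≡-Reasoning
  pad : ∀ a b → a ≡ a * 1 + b * 0
  pad = solve-∀
F-add m (suc n) = begin
  F (suc (m + suc n))                               ≡⟨ cong (F ∘ suc) (+-suc m n) ⟩
  F (suc (suc m + n))                               ≡⟨ F-add (suc m) n ⟩
  (F (suc m) + F m) * F (suc n) + F (suc m) * F n   ≡⟨ regroup (F (suc m)) (F m) (F (suc n)) (F n) ⟩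
  F (suc m) * (F (suc n) + F n) + F m * F (suc n)   ∎
  where
  open ≡-Reasoning
  regroup : ∀ a b c d → (a + b) * c + a * d ≡ a * (c + d) + b * c
  regroup = solve-∀

F[3+n]<3*F[1+n] : ∀ {n} → 2 ≤ n → F (3 + n) < 3 * F (1 + n)
F[3+n]<3*F[1+n] {n} 2≤n = begin-strict
  (t + s) + t  <⟨ +-monoˡ-< t (+-monoʳ-< t (F-<-suc 2≤n)) ⟩
  (t + t) + t  ≡⟨ triple t ⟩
  3 * t        ∎
  where
  open ≤-Reasoning
  triple : ∀ t → (t + t) + t ≡ 3 * t
  triple = solve-∀
  t s : ℕ
  t = F (1 + n)
  s = F n

F[4+n]<6*F[1+n] : ∀ n → F (4 + n) < 6 * F (1 + n)
F[4+n]<6*F[1+n] n = begin-strict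
  F (4 + n)          ≡⟨ F-add 3 n ⟩
  3 * t + 2 * s      ≤⟨ +-monoʳ-≤ (3 * t) (*-monoʳ-≤ 2 (F-≤-suc n)) ⟩
  3 * t + 2 * t      <⟨ m<m+n (3 * t + 2 * t) (F-mono-≤ {1} {1 + n} (s≤s z≤n)) ⟩
  3 * t + 2 * t + t  ≡⟨ sextuple t ⟩
  6 * t              ∎
  where
  open ≤-Reasoning
  sextuple : ∀ t → 3 * t + 2 * t + t ≡ 6 * t
  sextuple = solve-∀
  t s : ℕ
  t = F (1 + n)
  s = F n

K*F[b]≤F[k+j]⇒b≤j : ∀ k K {b j} → (∀ {n} → j ≤ n → F (k + n) < K * F (suc n)) →
                    K * F b ≤ F (k + j) → b ≤ j
K*F[b]≤F[k+j]⇒b≤j k K {0} _ _ = z≤n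
K*F[b]≤F[k+j]⇒b≤j k K {suc b} {j} growth bound with suc b ≤? j
... | yes b<j = b<j
... | no b≮j = contradiction bound (<⇒≱ F[k+j]<K*F[1+b])
  where
  j≤b : j ≤ b
  j≤b = ≤-pred (≰⇒> b≮j)
  F[k+j]<K*F[1+b] : F (k + j) < K * F (suc b)
  F[k+j]<K*F[1+b] = ≤-<-trans (F-mono-≤ (+-monoʳ-≤ k j≤b)) (growth j≤b)

m*m<n*n⇒m<n : ∀ {m n} → m * m < n * n → m < n
m*m<n*n⇒m<n {m} {n} m*m<n*n with m <? n
... | yes m<n = m<n
... | no m≮n = contradiction (*-mono-≤ n≤m n≤m) (<⇒≱ m*m<n*n)
  where
  n≤m : n ≤ m
  n≤m = ≮⇒≥ m≮n

m<n⇒o+m<n+o : ∀ {m n} o → m < n → o + m < n + o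
m<n⇒o+m<n+o {m} {n} o m<n = subst (o + m <_) (+-comm o n) (+-monoʳ-< o m<n)

x*x+y*y<3*x*y*z : ∀ {x y z} → 0 < x → x ≤ y → y ≤ z → x * x + y * y < 3 * x * y * z
x*x+y*y<3*x*y*z {x} {y} {z} 0<x x≤y y≤z = begin-strict
  x * x + y * y  ≤⟨ +-mono-≤ (≤-trans (*-mono-≤ x≤y x≤y) y*y≤P) y*y≤P ⟩
  P + P          <⟨ m<m+n (P + P) 0<P ⟩
  P + P + P      ≡⟨ tripled x y z ⟩
  3 * x * y * z  ∎
  where
  open ≤-Reasoning
  P : ℕ
  P = x * y * z
  0<y : 0 < y
  0<y = ≤-trans 0<x x≤y
  0<P : 0 < P
  0<P = *-mono-≤ (*-mono-≤ 0<x 0<y) (≤-trans 0<y y≤z)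
  y*y≤P : y * y ≤ P
  y*y≤P = *-mono-≤ (m≤n*m y x {{>-nonZero 0<x}}) y≤z
  tripled : ∀ x y z → x * y * z + x * y * z + x * y * z ≡ 3 * x * y * z
  tripled = solve-∀

markoff-m<z*z : ∀ {m x y z} → MarkoffTriple m x y z → m < z * z
markoff-m<z*z {m} {x} {y} {z} (0<x , x≤y , y≤z , markoff) =
  +-cancelˡ-< (3 * x * y * z) m (z * z) (begin-strict
    3 * x * y * z + m      ≡⟨ sym markoff ⟩
    x * x + y * y + z * z  <⟨ +-monoˡ-< (z * z) (x*x+y*y<3*x*y*z 0<x x≤y y≤z) ⟩
    3 * x * y * z + z * z  ∎)
  where open ≤-Reasoning

-- w² ≤ x² + y² + z² − 3xyz (the m of the triple), stated without truncated subtraction.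
_²≤ᴹ_ : ℕ → ℕ × ℕ × ℕ → Set
w ²≤ᴹ (x , y , z) = w * w + 3 * x * y * z ≤ x * x + y * y + z * z

markoff-²≤ᴹ⇒²≤m : ∀ {m w x y z} → MarkoffTriple m x y z → w ²≤ᴹ (x , y , z) → w * w ≤ m
markoff-²≤ᴹ⇒²≤m {m} {w} {x} {y} {z} (_ , _ , _ , markoff) w²≤ᴹ =
  +-cancelˡ-≤ (3 * x * y * z) (w * w) m (begin
    3 * x * y * z + w * w  ≡⟨ +-comm (3 * x * y * z) (w * w) ⟩
    w * w + 3 * x * y * z  ≤⟨ w²≤ᴹ ⟩
    x * x + y * y + z * z  ≡⟨ markoff ⟩
    3 * x * y * z + m      ∎)
  where open ≤-Reasoning

-- t² − y² = (t − y)(t + y) ≤ (t − y) · 3xz, because t + y ≤ 2z ≤ 3xz.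
²≤ᴹ-antitone : ∀ {w x y t z} → 0 < x → y ≤ t → t ≤ z → w ²≤ᴹ (x , t , z) → w ²≤ᴹ (x , y , z)
²≤ᴹ-antitone {w} {x} {y} {t} {z} 0<x y≤t t≤z w²≤ᴹ with m≤n⇒∃[o]m+o≡n y≤t
... | d , refl = +-cancelʳ-≤ (3 * x * d * z) (w * w + 3 * x * y * z) (x * x + y * y + z * z) (begin
  w * w + 3 * x * y * z + 3 * x * d * z      ≡⟨ expand-lhs w x y d z ⟩
  w * w + 3 * x * (y + d) * z                ≤⟨ w²≤ᴹ ⟩
  x * x + (y + d) * (y + d) + z * z          ≡⟨ expand-rhs x y d z ⟩
  x * x + y * y + z * z + d * (y + (y + d))  ≤⟨ +-monoʳ-≤ (x * x + y * y + z * z) (*-monoʳ-≤ d y+t≤3xz) ⟩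
  x * x + y * y + z * z + d * (3 * x * z)    ≡⟨ regroup x y d z ⟩
  x * x + y * y + z * z + 3 * x * d * z      ∎)
  where
  open ≤-Reasoning
  y+t≤3xz : y + (y + d) ≤ 3 * x * z
  y+t≤3xz = begin
    y + (y + d)        ≤⟨ +-mono-≤ (≤-trans y≤t t≤z) t≤z ⟩
    z + z              ≤⟨ +-monoʳ-≤ z (m≤m+n z (z + 0)) ⟩
    3 * z              ≤⟨ *-monoˡ-≤ z (*-monoʳ-≤ 3 0<x) ⟩
    3 * x * z          ∎
  expand-lhs : ∀ w x y d z → w * w + 3 * x * y * z + 3 * x * d * z ≡ w * w + 3 * x * (y + d) * z
  expand-lhs = solve-∀
  expand-rhs : ∀ x y d z → x * x + (y + d) * (y + d) + z * z ≡ x * x + y * y + z * z + d * (y + (y + d))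
  expand-rhs = solve-∀
  regroup : ∀ x y d z → x * x + y * y + z * z + d * (3 * x * z) ≡ x * x + y * y + z * z + 3 * x * d * z
  regroup = solve-∀

[t+s]²≤ᴹ[1,t,3t+2s] : ∀ t s → (t + s) ²≤ᴹ (1 , t , 3 * t + 2 * s)
[t+s]²≤ᴹ[1,t,3t+2s] t s = ≤″⇒≤ (_ , identity t s)
  where
  identity : ∀ t s → (t + s) * (t + s) + 3 * 1 * t * (3 * t + 2 * s) + (1 + 4 * t * s + 3 * s * s)
                     ≡ 1 * 1 + t * t + (3 * t + 2 * s) * (3 * t + 2 * s)
  identity = solve-∀

[3t+2s]²≤ᴹ[2,t,8t+5s] : ∀ t s → (3 * t + 2 * s) ²≤ᴹ (2 , t , 8 * t + 5 * s)
[3t+2s]²≤ᴹ[2,t,8t+5s] t s = ≤″⇒≤ (_ , identity t s)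
  where
  identity : ∀ t s → (3 * t + 2 * s) * (3 * t + 2 * s) + 3 * 2 * t * (8 * t + 5 * s)
                       + (4 + 8 * t * t + 38 * t * s + 21 * s * s)
                     ≡ 2 * 2 + t * t + (8 * t + 5 * s) * (8 * t + 5 * s)
  identity = solve-∀

[t+s+t]²≤ᴹ[2,t+s,8t+5s] : ∀ {t s} → s ≤ t → (t + s + t) ²≤ᴹ (2 , t + s , 8 * t + 5 * s)
[t+s+t]²≤ᴹ[2,t+s,8t+5s] {s = s} s≤t with m≤n⇒∃[o]m+o≡n s≤t
... | d , refl = ≤″⇒≤ (_ , identity s d)
  where
  identity : ∀ s d → (s + d + s + (s + d)) * (s + d + s + (s + d)) + 3 * 2 * (s + d + s) * (8 * (s + d) + 5 * s)
                       + (4 + 8 * s * s + 26 * s * d + 13 * d * d)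
                     ≡ 2 * 2 + (s + d + s) * (s + d + s) + (8 * (s + d) + 5 * s) * (8 * (s + d) + 5 * s)
  identity = solve-∀

markoff[1,Fb,F[4+n]]⇒F[2+n]²≤m : ∀ {m b} n → b ≤ 1 + n → MarkoffTriple m 1 (F b) (F (4 + n)) →
                                  F (2 + n) * F (2 + n) ≤ m
markoff[1,Fb,F[4+n]]⇒F[2+n]²≤m n b≤1+n T =
  markoff-²≤ᴹ⇒²≤m {w = F (2 + n)} T
    (²≤ᴹ-antitone {F (2 + n)} {1} (s≤s z≤n) (F-mono-≤ b≤1+n) (F-mono-≤ (m≤n+m (1 + n) 3)) at-b=1+n)
  where
  at-b=1+n : F (2 + n) ²≤ᴹ (1 , F (1 + n) , F (4 + n))
  at-b=1+n = subst (λ z → F (2 + n) ²≤ᴹ (1 , F (1 + n) , z)) (sym (F-add 3 n))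
                   ([t+s]²≤ᴹ[1,t,3t+2s] (F (1 + n)) (F n))

markoff[2,Fb,F[6+n]]⇒F[4+n]²≤m : ∀ {m b} n → b ≤ 1 + n → MarkoffTriple m 2 (F b) (F (6 + n)) →
                                  F (4 + n) * F (4 + n) ≤ m
markoff[2,Fb,F[6+n]]⇒F[4+n]²≤m n b≤1+n T =
  markoff-²≤ᴹ⇒²≤m {w = F (4 + n)} T
    (²≤ᴹ-antitone {F (4 + n)} {2} (s≤s z≤n) (F-mono-≤ b≤1+n) (F-mono-≤ (m≤n+m (1 + n) 5)) at-b=1+n)
  where
  at-b=1+n : F (4 + n) ²≤ᴹ (2 , F (1 + n) , F (6 + n))
  at-b=1+n = subst₂ (λ w z → w ²≤ᴹ (2 , F (1 + n) , z)) (sym (F-add 3 n)) (sym (F-add 5 n))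
                    ([3t+2s]²≤ᴹ[2,t,8t+5s] (F (1 + n)) (F n))

markoff[2,F[2+n],F[6+n]]⇒F[3+n]²≤m : ∀ {m} n → MarkoffTriple m 2 (F (2 + n)) (F (6 + n)) →
                                      F (3 + n) * F (3 + n) ≤ m
markoff[2,F[2+n],F[6+n]]⇒F[3+n]²≤m n T = markoff-²≤ᴹ⇒²≤m {w = F (3 + n)} T at-b=2+n
  where
  at-b=2+n : F (3 + n) ²≤ᴹ (2 , F (2 + n) , F (6 + n))
  at-b=2+n = subst (λ z → F (3 + n) ²≤ᴹ (2 , F (2 + n) , z)) (sym (F-add 5 n))
                   ([t+s+t]²≤ᴹ[2,t+s,8t+5s] (F-≤-suc n))

markoff-F[k]²≤m⇒k<c : ∀ {m x y k c} → F k * F k ≤ m → MarkoffTriple m x y (F c) → k < c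
markoff-F[k]²≤m⇒k<c F[k]²≤m T = F-cancel-< (m*m<n*n⇒m<n (≤-<-trans F[k]²≤m (markoff-m<z*z T)))

lemma4p10 : (m a b c a′ b′ c′ : ℕ) → 0 < m →
    2 ≤ a → a ≤ b → b ≤ c → 2 ≤ a′ → a′ ≤ b′ → b′ ≤ c′ → c′ ≤ c →
    MinimalMarkoffTriple m (F a) (F b) (F c) →
    MinimalMarkoffTriple m (F a′) (F b′) (F c′) →
    (a ≡ 2 ⊎ a ≡ 3) → 10 ≤ c →
    (¬ (a ≡ 3 × c ≡ b + 4) → c ≤ c′ + 1) ×
    (a ≡ 3 × c ≡ b + 4 → c ≤ c′ + 2)
lemma4p10 m a b c a′ b′ c′ _ _ _ _ _ _ _ _ (T , minimal) (T′ , _) a≡2⊎a≡3 10≤c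
  with m≤n⇒∃[o]m+o≡n 10≤c
... | r , refl with a≡2⊎a≡3
... | inj₁ refl = (λ _ → m<n⇒o+m<n+o 1 8+r<c′) , λ { (() , _) }
  where
  b≤7+r : b ≤ 7 + r
  b≤7+r = K*F[b]≤F[k+j]⇒b≤j 3 3 (λ 7+r≤n → F[3+n]<3*F[1+n] (≤-trans (s≤s (s≤s z≤n)) 7+r≤n)) minimal
  8+r<c′ : 8 + r < c′
  8+r<c′ = markoff-F[k]²≤m⇒k<c (markoff[1,Fb,F[4+n]]⇒F[2+n]²≤m (6 + r) b≤7+r T) T′
... | inj₂ refl with m≤n⇒m<n∨m≡n (K*F[b]≤F[k+j]⇒b≤j 4 6 {b} {6 + r} (λ {n} _ → F[4+n]<6*F[1+n] n) minimal)
...   | inj₁ b<6+r = (λ _ → m<n⇒o+m<n+o 1 8+r<c′) , (λ _ → <⇒≤ (m<n⇒o+m<n+o 2 8+r<c′))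
  where
  8+r<c′ : 8 + r < c′
  8+r<c′ = markoff-F[k]²≤m⇒k<c (markoff[2,Fb,F[6+n]]⇒F[4+n]²≤m (4 + r) (≤-pred b<6+r) T) T′
...   | inj₂ refl = (λ c≢b+4 → contradiction (refl , cong (6 +_) (+-comm 4 r)) c≢b+4) ,
                    (λ _ → m<n⇒o+m<n+o 2 7+r<c′)
  where
  7+r<c′ : 7 + r < c′
  7+r<c′ = markoff-F[k]²≤m⇒k<c (markoff[2,F[2+n],F[6+n]]⇒F[3+n]²≤m (4 + r) T) T′
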